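{- For every integer $n\ge 2$, there exists a maximal packing broadcast $f$ on the path $P_n$ of cost $p_b(P_n)$ such that $f(v)=1$ for every vertex $v$ with $f(v)>0$.
   Context: For a graph $G=(V,E)$, a broadcast is a function $f:V\to\{0,\dots,\operatorname{diam}(G)\}$ with $f(v)\le e_G(v)$ (eccentricity) for all $v$. Let $V^+_f=\{v: f(v)>0\}$ and $H_f(u)=\{v\in V^+_f: d_G(u,v)\le f(v)\}$. The cost is $\sigma(f)=\sum_v f(v)$. $f$ is a packing broadcast if $|H_f(u)|\le1$ for every $u\in V$; it is maximal if no packing broadcast $g\ne f$ satisfies $g\ge f$ pointwise. $p_b(G)$ is the minimum cost of a maximal packing broadcast on $G$. -}

module Defs where

open import Data.Nat using (ℕ; _≤_; _<_; _⊔_; _∸_; ∣_-_∣)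
open import Data.Fin using (Fin; toℕ)
open import Data.List using (tabulate)
open import Data.Nat.ListAction using (sum)
open import Data.Product using (_×_)
open import Relation.Binary.PropositionalEquality using (_≡_)

-- The path P_n has vertex set Fin n, with i adjacent to i+1.
-- Its graph distance:
dist : {n : ℕ} → Fin n → Fin n → ℕ
dist i j = ∣ toℕ i - toℕ j ∣

-- Eccentricity of v in P_n: max(v, n-1-v)  (the distance to the farther endpoint).
ecc : (n : ℕ) → Fin n → ℕ
ecc n v = toℕ v ⊔ (n ∸ 1 ∸ toℕ v)

-- A function f : V → ℕ is a broadcast on P_n iff f(v) ≤ e(v) for all v
-- (this also forces f(v) ≤ diam(P_n) = n-1).
IsBroadcast : (n : ℕ) → (Fin n → ℕ) → Set
IsBroadcast n f = ∀ v → f v ≤ ecc n v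

InH : {n : ℕ} → (Fin n → ℕ) → Fin n → Fin n → Set
InH f u v = (0 < f v) × (dist u v ≤ f v)

IsPacking : (n : ℕ) → (Fin n → ℕ) → Set
IsPacking n f = IsBroadcast n f × (∀ u v w → InH f u v → InH f u w → v ≡ w)

IsMaximalPacking : (n : ℕ) → (Fin n → ℕ) → Set
IsMaximalPacking n f =
  IsPacking n f × (∀ g → IsPacking n g → (∀ v → f v ≤ g v) → ∀ v → g v ≡ f v)

cost : {n : ℕ} → (Fin n → ℕ) → ℕ
cost f = sum (tabulate f)

-- f is a maximal packing broadcast of minimum cost, i.e. cost f = p_b(P_n)
IsPbBroadcast : (n : ℕ) → (Fin n → ℕ) → Set
IsPbBroadcast n f =
  IsMaximalPacking n f × (∀ g → IsMaximalPacking n g → cost f ≤ cost g)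

-- Let g be a maximal packing broadcast on P_n of cost σ with m broadcasting vertices.
-- If some range [v - g v, v + g v] already reaches both path ends then n ≤ 2σ + 1.  Otherwise
-- maximality says that no value can be raised by one: every uncovered vertex has a covered
-- neighbour, and every range is bordered on the left or on the right by a covered vertex.  The
-- disjoint ranges cover at most 2σ + m vertices.  Call a range left-open if the vertex just before
-- it is not covered, and let a be the number of left-open ranges.  Each run of covered vertices
-- begins with a left-open range and each gap has at most two vertices, so at most 2a vertices are
-- uncovered; and the range following a left-open one is left-closed, so 2a ≤ m ≤ σ.  Hence
-- n ≤ 3σ + 2⌊σ/2⌋ = capacity σ.  Ones at positions 2 and 5 of consecutive blocks of eight vertices, followed by a
-- short pattern on the last n mod 8 vertices (the centre alone for P_3), form a maximal packing
-- broadcast whose cost is the least σ with n ≤ capacity σ.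
module Submission where

open import Defs
open import Data.Nat using (ℕ; _≤_; _<_)
open import Data.Fin using (Fin)
open import Data.Product using (Σ; _×_)
open import Relation.Binary.PropositionalEquality using (_≡_)

open import Data.Nat
open import Data.Nat.Properties
open import Data.Nat.Tactic.RingSolver using (solve-∀)
open import Data.Fin as Fin using (toℕ; fromℕ<)
open import Data.Fin.Properties using (toℕ-injective; toℕ<n; toℕ-fromℕ<)
open import Data.Product
open import Data.Sum
open import Data.Empty
open import Data.Unit using (tt)
open import Function using (_∘_; id)
open import Relation.Nullary
open import Relation.Nullary.Decidable using (map′; toWitness; _→-dec_)
open import Relation.Unary using (Decidable)
open import Relation.Binary.PropositionalEquality
open import Algebra.Properties.CommutativeSemigroup +-commutativeSemigroup using (interchange)

∑ : ℕ → (ℕ → ℕ) → ℕ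
∑ zero    h = 0
∑ (suc n) h = h 0 + ∑ n (h ∘ suc)

∑-cong : ∀ n {a b : ℕ → ℕ} → (∀ {u} → u < n → a u ≡ b u) → ∑ n a ≡ ∑ n b
∑-cong zero    a≡b = refl
∑-cong (suc n) a≡b = cong₂ _+_ (a≡b z<s) (∑-cong n (a≡b ∘ s<s))

∑-mono-≤ : ∀ n {a b : ℕ → ℕ} → (∀ {u} → u < n → a u ≤ b u) → ∑ n a ≤ ∑ n b
∑-mono-≤ zero    a≤b = z≤n
∑-mono-≤ (suc n) a≤b = +-mono-≤ (a≤b z<s) (∑-mono-≤ n (a≤b ∘ s<s))

∑-zero : ∀ n {h : ℕ → ℕ} → (∀ {u} → u < n → h u ≡ 0) → ∑ n h ≡ 0
∑-zero zero    h≡0 = refl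
∑-zero (suc n) h≡0 = cong₂ _+_ (h≡0 z<s) (∑-zero n (h≡0 ∘ s<s))

∑-const-1 : ∀ n → ∑ n (λ _ → 1) ≡ n
∑-const-1 zero    = refl
∑-const-1 (suc n) = cong suc (∑-const-1 n)

∑-distrib-+ : ∀ n (a b : ℕ → ℕ) → ∑ n (λ u → a u + b u) ≡ ∑ n a + ∑ n b
∑-distrib-+ zero    a b = refl
∑-distrib-+ (suc n) a b = begin
  a 0 + b 0 + ∑ n (λ u → a (suc u) + b (suc u))  ≡⟨ cong (a 0 + b 0 +_) (∑-distrib-+ n (a ∘ suc) (b ∘ suc)) ⟩
  a 0 + b 0 + (∑ n (a ∘ suc) + ∑ n (b ∘ suc))    ≡⟨ interchange (a 0) (b 0) _ _ ⟩
  a 0 + ∑ n (a ∘ suc) + (b 0 + ∑ n (b ∘ suc))    ∎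
  where open ≡-Reasoning

∑-comm : ∀ n N (R : ℕ → ℕ → ℕ) → ∑ n (λ u → ∑ N (R u)) ≡ ∑ N (λ w → ∑ n (λ u → R u w))
∑-comm zero    N R = sym (∑-zero N (λ _ → refl))
∑-comm (suc n) N R = begin
  ∑ N (R 0) + ∑ n (λ u → ∑ N (R (suc u)))         ≡⟨ cong (∑ N (R 0) +_) (∑-comm n N (R ∘ suc)) ⟩
  ∑ N (R 0) + ∑ N (λ w → ∑ n (λ u → R (suc u) w)) ≡⟨ ∑-distrib-+ N (R 0) _ ⟨
  ∑ N (λ w → R 0 w + ∑ n (λ u → R (suc u) w))     ∎
  where open ≡-Reasoning

term≤∑ : ∀ n (h : ℕ → ℕ) {j} → j < n → h j ≤ ∑ n h
term≤∑ (suc n) h {zero}  _         = m≤m+n (h 0) _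
term≤∑ (suc n) h {suc j} (s<s j<n) = ≤-trans (term≤∑ n (h ∘ suc) j<n) (m≤n+m _ (h 0))

∑≤∑-suc : ∀ n (h : ℕ → ℕ) → ∑ n h ≤ ∑ (suc n) h
∑≤∑-suc zero    h = z≤n
∑≤∑-suc (suc n) h = +-monoʳ-≤ (h 0) (∑≤∑-suc n (h ∘ suc))

shift : (ℕ → ℕ) → ℕ → ℕ
shift h zero    = 0
shift h (suc u) = h u

∑-shift≤ : ∀ n (h : ℕ → ℕ) → ∑ n (shift h) ≤ ∑ n h
∑-shift≤ zero    h = z≤n
∑-shift≤ (suc n) h = ∑≤∑-suc n h

χ : {P : Set} → Dec P → ℕ
χ (yes _) = 1
χ (no _)  = 0

χ-yes : {P : Set} (P? : Dec P) → P → χ P? ≡ 1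
χ-yes (yes _) _ = refl
χ-yes (no ¬p) p = ⊥-elim (¬p p)

χ-no : {P : Set} (P? : Dec P) → ¬ P → χ P? ≡ 0
χ-no (yes p) ¬p = ⊥-elim (¬p p)
χ-no (no _)  _  = refl

χ-mono : {P Q : Set} (P? : Dec P) (Q? : Dec Q) → (P → Q) → χ P? ≤ χ Q?
χ-mono (yes p) Q? P⇒Q = ≤-reflexive (sym (χ-yes Q? (P⇒Q p)))
χ-mono (no _)  Q? P⇒Q = z≤n

χ+χ≤χ : {P Q R : Set} (P? : Dec P) (Q? : Dec Q) (R? : Dec R) →
        (P → R) → (Q → R) → (P → ¬ Q) → χ P? + χ Q? ≤ χ R?
χ+χ≤χ (yes p) (yes q) R? P⇒R Q⇒R P⇒¬Q = ⊥-elim (P⇒¬Q p q)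
χ+χ≤χ (yes p) (no _)  R? P⇒R Q⇒R P⇒¬Q = ≤-reflexive (sym (χ-yes R? (P⇒R p)))
χ+χ≤χ (no _)  Q?      R? P⇒R Q⇒R P⇒¬Q = χ-mono Q? R? Q⇒R

count : {P : ℕ → Set} → Decidable P → ℕ → ℕ
count P? n = ∑ n (χ ∘ P?)

count-none : ∀ {P : ℕ → Set} (P? : Decidable P) n → (∀ {u} → u < n → ¬ P u) → count P? n ≡ 0
count-none P? n ¬P = ∑-zero n (λ u<n → χ-no (P? _) (¬P u<n))

count-mono : ∀ {P Q : ℕ → Set} (P? : Decidable P) (Q? : Decidable Q) n →
             (∀ {u} → u < n → P u → Q u) → count P? n ≤ count Q? n
count-mono P? Q? n P⇒Q = ∑-mono-≤ n (λ u<n → χ-mono (P? _) (Q? _) (P⇒Q u<n))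

count+count-¬≡n : ∀ {P : ℕ → Set} (P? : Decidable P) n → count P? n + count (¬? ∘ P?) n ≡ n
count+count-¬≡n P? n = begin
  count P? n + count (¬? ∘ P?) n          ≡⟨ ∑-distrib-+ n _ _ ⟨
  ∑ n (λ u → χ (P? u) + χ (¬? (P? u)))   ≡⟨ ∑-cong n (λ {u} _ → χ+χ-¬≡1 (P? u)) ⟩
  ∑ n (λ _ → 1)                           ≡⟨ ∑-const-1 n ⟩
  n                                       ∎
  where
  open ≡-Reasoning
  χ+χ-¬≡1 : {Q : Set} (Q? : Dec Q) → χ Q? + χ (¬? Q?) ≡ 1
  χ+χ-¬≡1 (yes _) = refl
  χ+χ-¬≡1 (no _)  = refl

χ≤count : ∀ {P : Set} {Q : ℕ → Set} (P? : Dec P) (Q? : Decidable Q) n →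
          (P → ∃ λ w → w < n × Q w) → χ P? ≤ count Q? n
χ≤count (yes p) Q? n witness with witness p
... | w , w<n , qw = ≤-trans (≤-reflexive (sym (χ-yes (Q? w) qw))) (term≤∑ n (χ ∘ Q?) w<n)
χ≤count (no _)  Q? n witness = z≤n

count-unique≤χ : ∀ {P : ℕ → Set} {R : Set} (P? : Decidable P) (R? : Dec R) n →
                 (∀ {u v} → u < n → v < n → P u → P v → u ≡ v) → (∀ {u} → u < n → P u → R) →
                 count P? n ≤ χ R?
count-unique≤χ P? R? zero    unique P⇒R = z≤n
count-unique≤χ P? R? (suc n) unique P⇒R with P? 0
... | yes p = ≤-reflexive (trans (cong (1 +_) rest≡0) (sym (χ-yes R? (P⇒R z<s p))))
  where
  rest≡0 : count (P? ∘ suc) n ≡ 0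
  rest≡0 = count-none (P? ∘ suc) n (λ u<n pu → 0≢1+n (unique z<s (s<s u<n) p pu))
... | no _  = count-unique≤χ (P? ∘ suc) R? n (λ u<n v<n pu pv → suc-injective (unique (s<s u<n) (s<s v<n) pu pv))
                             (P⇒R ∘ s<s)

module _ {P : ℕ → Set} {R : ℕ → ℕ → Set} (P? : Decidable P) (R? : ∀ u w → Dec (R u w)) (n N : ℕ) where

  count≤∑count : (∀ {u} → u < n → P u → ∃ λ w → w < N × R u w) →
                 count P? n ≤ ∑ N (λ w → count (λ u → R? u w) n)
  count≤∑count related = begin
    count P? n                           ≤⟨ ∑-mono-≤ n (λ u<n → χ≤count (P? _) (R? _) N (related u<n)) ⟩
    ∑ n (λ u → ∑ N (λ w → χ (R? u w)))  ≡⟨ ∑-comm n N (λ u w → χ (R? u w)) ⟩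
    ∑ N (λ w → count (λ u → R? u w) n)  ∎
    where open ≤-Reasoning

  count-≤-matching : {Q : ℕ → Set} (Q? : Decidable Q) →
                     (∀ {u} → u < n → P u → ∃ λ w → w < N × R u w) →
                     (∀ {u v w} → u < n → v < n → w < N → R u w → R v w → u ≡ v) →
                     (∀ {u w} → u < n → w < N → R u w → Q w) →
                     count P? n ≤ count Q? N
  count-≤-matching Q? related unique R⇒Q =
    ≤-trans (count≤∑count related)
            (∑-mono-≤ N (λ w<N → count-unique≤χ (λ u → R? u _) (Q? _) n
                                   (λ u<n v<n → unique u<n v<n w<N) (λ u<n → R⇒Q u<n w<N)))

Rise Fall : (ℕ → Set) → ℕ → Set
Rise C u = ¬ C u × C (suc u)
Fall C u = C u × ¬ C (suc u)

rise? : {C : ℕ → Set} → Decidable C → Decidable (Rise C)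
rise? C? u = ¬? (C? u) ×-dec C? (suc u)

fall? : {C : ℕ → Set} → Decidable C → Decidable (Fall C)
fall? C? u = C? u ×-dec ¬? (C? (suc u))

falls+last≡rises+first : ∀ {C : ℕ → Set} (C? : Decidable C) n →
                         count (fall? C?) n + χ (C? n) ≡ count (rise? C?) n + χ (C? 0)
falls+last≡rises+first C? zero    = refl
falls+last≡rises+first C? (suc n) = begin
  f₀ + count (fall? C? ∘ suc) n + χ (C? (suc n))   ≡⟨ +-assoc f₀ _ _ ⟩
  f₀ + (count (fall? C? ∘ suc) n + χ (C? (suc n))) ≡⟨ cong (f₀ +_) (falls+last≡rises+first (C? ∘ suc) n) ⟩
  f₀ + (r′ + χ (C? 1))                             ≡⟨ +-comm f₀ _ ⟩
  r′ + χ (C? 1) + f₀                               ≡⟨ +-assoc r′ _ _ ⟩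
  r′ + (χ (C? 1) + f₀)                             ≡⟨ cong (r′ +_) (step (C? 0) (C? 1)) ⟩
  r′ + (r₀ + χ (C? 0))                             ≡⟨ +-assoc r′ _ _ ⟨
  r′ + r₀ + χ (C? 0)                               ≡⟨ cong (_+ χ (C? 0)) (+-comm r′ r₀) ⟩
  r₀ + r′ + χ (C? 0)                               ∎
  where
  open ≡-Reasoning
  f₀ r₀ r′ : ℕ
  f₀ = χ (fall? C? 0)
  r₀ = χ (rise? C? 0)
  r′ = count (rise? C? ∘ suc) n
  step : {A B : Set} (A? : Dec A) (B? : Dec B) → χ B? + χ (A? ×-dec ¬? B?) ≡ χ (¬? A? ×-dec B?) + χ A?
  step (yes _) (yes _) = refl
  step (yes _) (no _)  = refl
  step (no _)  (yes _) = refl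
  step (no _)  (no _)  = refl

count-¬≤rises+falls : ∀ {C : ℕ → Set} (C? : Decidable C) n →
                      (∀ {u} → u < n → ¬ C u → C (suc u) ⊎ ∃ λ u′ → u ≡ suc u′ × C u′) →
                      count (¬? ∘ C?) n ≤ count (rise? C?) n + count (fall? C?) n
count-¬≤rises+falls {C} C? n neighbour = begin
  count (¬? ∘ C?) n                                    ≤⟨ ∑-mono-≤ n (λ {u} u<n → pointwise u<n (¬? (C? u))) ⟩
  ∑ n (λ u → χ (rise? C? u) + shift (χ ∘ fall? C?) u)  ≡⟨ ∑-distrib-+ n _ _ ⟩
  count (rise? C?) n + ∑ n (shift (χ ∘ fall? C?))      ≤⟨ +-monoʳ-≤ (count (rise? C?) n) (∑-shift≤ n _) ⟩
  count (rise? C?) n + count (fall? C?) n              ∎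
  where
  open ≤-Reasoning
  pointwise : ∀ {u} → u < n → (¬C? : Dec (¬ C u)) → χ ¬C? ≤ χ (rise? C? u) + shift (χ ∘ fall? C?) u
  pointwise u<n (no _) = z≤n
  pointwise {u} u<n (yes ¬Cu) with neighbour u<n ¬Cu
  ... | inj₁ Cu+1              = ≤-trans (≤-reflexive (sym (χ-yes (rise? C? u) (¬Cu , Cu+1)))) (m≤m+n _ _)
  ... | inj₂ (u′ , refl , Cu′) = ≤-trans (≤-reflexive (sym (χ-yes (fall? C? u′) (Cu′ , ¬Cu)))) (m≤n+m _ _)

∣-∣≤⇒ : ∀ {a b k} → ∣ a - b ∣ ≤ k → a ≤ b + k × b ≤ a + k
∣-∣≤⇒ {a} {b} d≤k = ≤-trans (m≤n+∣m-n∣ a b) (+-monoʳ-≤ b d≤k) , ≤-trans (m≤n+∣n-m∣ b a) (+-monoʳ-≤ a d≤k)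

≤⇒∣-∣≤ : ∀ {a b k} → a ≤ b + k → b ≤ a + k → ∣ a - b ∣ ≤ k
≤⇒∣-∣≤ {zero}  {b}     _         b≤k       = b≤k
≤⇒∣-∣≤ {suc a} {zero}  a<k       _         = a<k
≤⇒∣-∣≤ {suc a} {suc b} (s≤s a≤b) (s≤s b≤a) = ≤⇒∣-∣≤ {a} {b} a≤b b≤a

∣m+n-m∣≡n : ∀ m n → ∣ m + n - m ∣ ≡ n
∣m+n-m∣≡n m n = trans (∣-∣-comm (m + n) m) (∣m-m+n∣≡n m n)

∣1+n-n∣≡1 : ∀ n → ∣ suc n - n ∣ ≡ 1
∣1+n-n∣≡1 zero    = refl
∣1+n-n∣≡1 (suc n) = ∣1+n-n∣≡1 n

exact-distance : ∀ {a b k} → ∣ a - b ∣ ≤ suc k → ¬ ∣ a - b ∣ ≤ k → a ≡ suc (b + k) ⊎ b ≡ suc (a + k)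
exact-distance {a} {b} {k} d≤1+k d≰k with ∣-∣≤⇒ d≤1+k | a ≤? b + k
... | _ , b≤a+1+k | yes a≤b+k =
  inj₂ (≤-antisym (≤-trans b≤a+1+k (≤-reflexive (+-suc a k))) (≰⇒> (λ b≤a+k → d≰k (≤⇒∣-∣≤ a≤b+k b≤a+k))))
... | a≤b+1+k , _ | no a≰b+k =
  inj₁ (≤-antisym (≤-trans a≤b+1+k (≤-reflexive (+-suc b k))) (≰⇒> a≰b+k))

left-end-of-range : ∀ {u w k} → ∣ suc u - w ∣ ≤ k → ¬ ∣ u - w ∣ ≤ k → w ∸ k ≡ suc u
left-end-of-range {u} {w} {k} d≤k d′≰k with exact-distance {u} {w} {k} d′≤1+k d′≰k
  where
  d′≤1+k : ∣ u - w ∣ ≤ suc k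
  d′≤1+k with ∣-∣≤⇒ d≤k
  ... | 1+u≤w+k , w≤1+u+k =
    ≤⇒∣-∣≤ (≤-trans (n≤1+n u) (≤-trans (m≤n⇒m≤1+n 1+u≤w+k) (≤-reflexive (sym (+-suc w k)))))
           (≤-trans w≤1+u+k (≤-reflexive (sym (+-suc u k))))
... | inj₁ refl = ⊥-elim (1+n≰n (≤-trans (n≤1+n _) (proj₁ (∣-∣≤⇒ {b = w} d≤k))))
... | inj₂ refl = m+n∸n≡m (suc u) k

midpoint : ∀ {x w} → ∣ x - w ∣ ≤ 2 → ∃ λ u → u ≤ x ⊔ w × ∣ u - x ∣ ≤ 1 × ∣ u - w ∣ ≤ 1
midpoint {x} {w} d≤2 with ∣ x - w ∣ ≤? 1
... | yes d≤1 = x , m≤m⊔n x w , ≤-trans (≤-reflexive (∣n-n∣≡0 x)) z≤n , d≤1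
... | no d≰1 with exact-distance {x} {w} d≤2 d≰1
...   | inj₁ refl = suc w , ≤-trans (s≤s (m≤m+n w 1)) (m≤m⊔n x w) ,
                    ≤-reflexive (∣m-m+n∣≡n w 1) , ≤-reflexive (∣1+n-n∣≡1 w)
...   | inj₂ refl = suc x , ≤-trans (s≤s (m≤m+n x 1)) (m≤n⊔m x w) ,
                    ≤-reflexive (∣1+n-n∣≡1 x) , ≤-reflexive (∣m-m+n∣≡n x 1)

two-and-one-from-three : ∀ {x w} → ∣ x - w ∣ ≡ 3 → ∃ λ u → u ≤ x ⊔ w × ∣ u - x ∣ ≤ 2 × ∣ u - w ∣ ≤ 1
two-and-one-from-three {x} {w} d≡3
  with exact-distance {x} {w} {2} (≤-reflexive d≡3) (λ d≤2 → 1+n≰n (≤-trans (≤-reflexive (sym d≡3)) d≤2))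
... | inj₁ refl = suc w , ≤-trans (s≤s (m≤m+n w 2)) (m≤m⊔n x w) ,
                  ≤-reflexive (∣m-m+n∣≡n w 2) , ≤-reflexive (∣1+n-n∣≡1 w)
... | inj₂ refl = x + 2 , ≤-trans (n≤1+n (x + 2)) (m≤n⊔m x w) ,
                  ≤-reflexive (∣m+n-m∣≡n x 2) , ≤-reflexive (trans (∣-∣-comm (x + 2) _) (∣1+n-n∣≡1 (x + 2)))

count-∣-∣≤ : ∀ n w k → count (λ u → ∣ u - w ∣ ≤? k) n ≤ suc (k + k)
count-∣-∣≤ n w k = begin
  count (λ u → ∣ u - w ∣ ≤? k) n      ≤⟨ count-≤-matching (λ u → ∣ u - w ∣ ≤? k) R? n (suc (k + k)) (λ _ → yes tt)
                                            related unique (λ _ _ _ → tt) ⟩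
  count (λ _ → yes tt) (suc (k + k))  ≡⟨ ∑-const-1 (suc (k + k)) ⟩
  suc (k + k)                         ∎
  where
  open ≤-Reasoning
  R? : ∀ u j → Dec (∣ u - w ∣ ≤ k × j ≡ u + k ∸ w)
  R? u j = (∣ u - w ∣ ≤? k) ×-dec (j ≟ u + k ∸ w)
  related : ∀ {u} → u < n → ∣ u - w ∣ ≤ k → ∃ λ j → j < suc (k + k) × (∣ u - w ∣ ≤ k × j ≡ u + k ∸ w)
  related {u} _ d≤k = u + k ∸ w , s≤s (m≤n+o⇒m∸n≤o (u + k) w u+k≤w+2k) , d≤k , refl
    where
    u+k≤w+2k : u + k ≤ w + (k + k)
    u+k≤w+2k = ≤-trans (+-monoˡ-≤ k (proj₁ (∣-∣≤⇒ d≤k))) (≤-reflexive (+-assoc w k k))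
  unique : ∀ {u v j} → u < n → v < n → j < suc (k + k) →
           ∣ u - w ∣ ≤ k × j ≡ u + k ∸ w → ∣ v - w ∣ ≤ k × j ≡ v + k ∸ w → u ≡ v
  unique {u} {v} _ _ _ (du , refl) (dv , j≡) =
    +-cancelʳ-≡ k u v (∸-cancelʳ-≡ (proj₂ (∣-∣≤⇒ du)) (proj₂ (∣-∣≤⇒ dv)) j≡)

eccℕ : ℕ → ℕ → ℕ
eccℕ n x = x ⊔ (n ∸ 1 ∸ x)

eccℕ≥1 : ∀ {n} x → 2 ≤ n → 1 ≤ eccℕ n x
eccℕ≥1 {suc (suc n)} zero    _        = s≤s z≤n
eccℕ≥1 {suc zero}    zero    (s≤s ())
eccℕ≥1 {n}           (suc x) _        = ≤-trans (s≤s z≤n) (m≤m⊔n (suc x) (n ∸ 1 ∸ suc x))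

n≤1+2ecc : ∀ {n x} → x < n → n ≤ suc (eccℕ n x + eccℕ n x)
n≤1+2ecc {suc n} {x} (s≤s x≤n) = s≤s (begin
  n                                ≡⟨ m+[n∸m]≡n x≤n ⟨
  x + (n ∸ x)                      ≤⟨ +-mono-≤ (m≤m⊔n x (n ∸ x)) (m≤n⊔m x (n ∸ x)) ⟩
  eccℕ (suc n) x + eccℕ (suc n) x  ∎)
  where open ≤-Reasoning

-- Hears n H u v is v ∈ H_f(u), for f given by H on the vertices x < n.
Hears : ℕ → (ℕ → ℕ) → ℕ → ℕ → Set
Hears n H u v = v < n × (0 < H v × ∣ u - v ∣ ≤ H v)

Covered : ℕ → (ℕ → ℕ) → ℕ → Set
Covered n H u = u < n × ∃ (Hears n H u)

covered? : ∀ n H → Decidable (Covered n H)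
covered? n H u = u <? n ×-dec anyUpTo? (λ v → 0 <? H v ×-dec ∣ u - v ∣ ≤? H v) n

Broadcastℕ : ℕ → (ℕ → ℕ) → Set
Broadcastℕ n H = ∀ {x} → x < n → H x ≤ eccℕ n x

Packingℕ : ℕ → (ℕ → ℕ) → Set
Packingℕ n H = ∀ {u v w} → u < n → Hears n H u v → Hears n H u w → v ≡ w

record IsMaximalPackingℕ (n : ℕ) (G : ℕ → ℕ) : Set where
  field
    broadcast : Broadcastℕ n G
    packing   : Packingℕ n G
    maximal   : ∀ {H} → Broadcastℕ n H → Packingℕ n H → (∀ {x} → x < n → G x ≤ H x) →
                ∀ {x} → x < n → H x ≡ G x

extend : (n : ℕ) → (Fin n → ℕ) → ℕ → ℕ
extend zero    h u       = 0
extend (suc n) h zero    = h Fin.zero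
extend (suc n) h (suc u) = extend n (h ∘ Fin.suc) u

extend-toℕ : ∀ n (h : Fin n → ℕ) i → extend n h (toℕ i) ≡ h i
extend-toℕ (suc n) h Fin.zero    = refl
extend-toℕ (suc n) h (Fin.suc i) = extend-toℕ n (h ∘ Fin.suc) i

cost≡∑-extend : ∀ n (h : Fin n → ℕ) → cost h ≡ ∑ n (extend n h)
cost≡∑-extend zero    h = refl
cost≡∑-extend (suc n) h = cong (h Fin.zero +_) (cost≡∑-extend n (h ∘ Fin.suc))

cost≡∑ : ∀ n (H : ℕ → ℕ) → cost (λ (i : Fin n) → H (toℕ i)) ≡ ∑ n H
cost≡∑ zero    H = refl
cost≡∑ (suc n) H = cong (H 0 +_) (cost≡∑ n (H ∘ suc))

toℕ-onto : ∀ {n x} → x < n → ∃ λ (i : Fin n) → toℕ i ≡ x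
toℕ-onto x<n = fromℕ< x<n , toℕ-fromℕ< x<n

module _ {n : ℕ} where

  broadcast→ℕ : {g : Fin n → ℕ} → IsBroadcast n g → Broadcastℕ n (extend n g)
  broadcast→ℕ {g} bc x<n with toℕ-onto x<n
  ... | i , refl = subst (_≤ ecc n i) (sym (extend-toℕ n g i)) (bc i)

  packing→ℕ : {g : Fin n → ℕ} → IsPacking n g → Packingℕ n (extend n g)
  packing→ℕ {g} (_ , unique) u<n (v<n , hv) (w<n , hw) with toℕ-onto u<n | toℕ-onto v<n | toℕ-onto w<n
  ... | i , refl | j , refl | k , refl = cong toℕ (unique i j k (heard j hv) (heard k hw))
    where
    heard : ∀ j → 0 < extend n g (toℕ j) × ∣ toℕ i - toℕ j ∣ ≤ extend n g (toℕ j) → InH g i j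
    heard j = subst (λ r → 0 < r × ∣ toℕ i - toℕ j ∣ ≤ r) (extend-toℕ n g j)

  packing←ℕ : {H : ℕ → ℕ} → Broadcastℕ n H → Packingℕ n H → IsPacking n (λ i → H (toℕ i))
  packing←ℕ bc pk = (λ i → bc (toℕ<n i)) ,
    λ u v w (v>0 , dv) (w>0 , dw) → toℕ-injective (pk (toℕ<n u) (toℕ<n v , v>0 , dv) (toℕ<n w , w>0 , dw))

  maximal→ℕ : {g : Fin n → ℕ} → IsMaximalPacking n g → IsMaximalPackingℕ n (extend n g)
  maximal→ℕ {g} ((bc , pk) , max) = record
    { broadcast = broadcast→ℕ bc
    ; packing   = packing→ℕ (bc , pk)
    ; maximal   = maximal
    }
    where
    maximal : ∀ {H} → Broadcastℕ n H → Packingℕ n H → (∀ {x} → x < n → extend n g x ≤ H x) →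
              ∀ {x} → x < n → H x ≡ extend n g x
    maximal {H} bcH pkH g≤H x<n with toℕ-onto x<n
    ... | i , refl = trans (max (λ j → H (toℕ j)) (packing←ℕ bcH pkH) g≤H′ i) (sym (extend-toℕ n g i))
      where
      g≤H′ : ∀ j → g j ≤ H (toℕ j)
      g≤H′ j = subst (_≤ H (toℕ j)) (extend-toℕ n g j) (g≤H (toℕ<n j))

  maximal←ℕ : {G : ℕ → ℕ} → IsMaximalPackingℕ n G → IsMaximalPacking n (λ i → G (toℕ i))
  maximal←ℕ {G} max = packing←ℕ broadcast packing , maximal′
    where
    open IsMaximalPackingℕ max
    maximal′ : ∀ g → IsPacking n g → (∀ i → G (toℕ i) ≤ g i) → ∀ i → g i ≡ G (toℕ i)
    maximal′ g (bc , pk) G≤g i =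
      trans (sym (extend-toℕ n g i)) (maximal (broadcast→ℕ bc) (packing→ℕ (bc , pk)) G≤g′ (toℕ<n i))
      where
      G≤g′ : ∀ {x} → x < n → G x ≤ extend n g x
      G≤g′ x<n with toℕ-onto x<n
      ... | j , refl = subst (G (toℕ j) ≤_) (sym (extend-toℕ n g j)) (G≤g j)

-- Consequences of maximality

raise : (ℕ → ℕ) → ℕ → ℕ → ℕ
raise G x y = χ (y ≟ x) + G y

module _ (n : ℕ) (G : ℕ → ℕ) (x : ℕ) where

  raise-at : raise G x x ≡ suc (G x)
  raise-at = cong (_+ G x) (χ-yes (x ≟ x) refl)

  raise-elsewhere : ∀ {y} → y ≢ x → raise G x y ≡ G y
  raise-elsewhere y≢x = cong (_+ G _) (χ-no (_ ≟ x) y≢x)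

  hears-raise : ∀ {y v} → Hears n (raise G x) y v →
                (v ≡ x × ∣ y - x ∣ ≤ suc (G x)) ⊎ (v ≢ x × Hears n G y v)
  hears-raise {y} {v} (v<n , v>0 , d) = by-cases (v ≟ x)
    where
    by-cases : Dec (v ≡ x) → (v ≡ x × ∣ y - x ∣ ≤ suc (G x)) ⊎ (v ≢ x × Hears n G y v)
    by-cases (yes v≡x) =
      inj₁ (v≡x , subst (∣ y - x ∣ ≤_) raise-at (subst (λ v′ → ∣ y - v′ ∣ ≤ raise G x v′) v≡x d))
    by-cases (no v≢x)  = inj₂ (v≢x , v<n , subst (λ r → 0 < r × ∣ y - v ∣ ≤ r) (raise-elsewhere v≢x) (v>0 , d))

  raise-packing : Packingℕ n G → (∀ {y w} → y < n → ∣ y - x ∣ ≤ suc (G x) → Hears n G y w → w ≡ x) →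
                  Packingℕ n (raise G x)
  raise-packing pk quiet {y} y<n hv hw with hears-raise {y} hv | hears-raise {y} hw
  ... | inj₁ (refl , _)  | inj₁ (refl , _)  = refl
  ... | inj₁ (refl , d)  | inj₂ (w≢x , hw′) = ⊥-elim (w≢x (quiet {y} y<n d hw′))
  ... | inj₂ (v≢x , hv′) | inj₁ (refl , d)  = ⊥-elim (v≢x (quiet {y} y<n d hv′))
  ... | inj₂ (_ , hv′)   | inj₂ (_ , hw′)   = pk y<n hv′ hw′

  raise-broadcast : Broadcastℕ n G → suc (G x) ≤ eccℕ n x → Broadcastℕ n (raise G x)
  raise-broadcast bc room {y} y<n = by-cases (y ≟ x)
    where
    by-cases : Dec (y ≡ x) → raise G x y ≤ eccℕ n y
    by-cases (yes y≡x) =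
      subst (λ y′ → raise G x y′ ≤ eccℕ n y′) (sym y≡x) (subst (_≤ eccℕ n x) (sym raise-at) room)
    by-cases (no y≢x)  = subst (_≤ eccℕ n y) (sym (raise-elsewhere y≢x)) (bc y<n)

HearsOther : ℕ → (ℕ → ℕ) → ℕ → ℕ → Set
HearsOther n G x y = ∃ λ w → w ≢ x × Hears n G y w

hearsOther? : ∀ n G x → Decidable (HearsOther n G x)
hearsOther? n G x y =
  map′ (λ (w , w<n , w≢x , h) → w , w≢x , w<n , h) (λ (w , w≢x , w<n , h) → w , w<n , w≢x , h)
       (anyUpTo? (λ w → ¬? (w ≟ x) ×-dec (0 <? G w ×-dec ∣ y - w ∣ ≤? G w)) n)

LeftCovered RightCovered : ℕ → (ℕ → ℕ) → ℕ → Set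
LeftCovered  n G v = 1 ≤ v ∸ G v × Covered n G (v ∸ G v ∸ 1)
RightCovered n G v = Covered n G (suc (v + G v))

module Maximality {n} {G : ℕ → ℕ} (max : IsMaximalPackingℕ n G) where

  open IsMaximalPackingℕ max

  raise-interferes : ∀ {x} → x < n → suc (G x) ≤ eccℕ n x →
                     ∃ λ y → y < n × (∣ y - x ∣ ≤ suc (G x) × HearsOther n G x y)
  raise-interferes {x} x<n room with anyUpTo? (λ y → ∣ y - x ∣ ≤? suc (G x) ×-dec hearsOther? n G x y) n
  ... | yes interference = interference
  ... | no ¬interference = ⊥-elim (1+n≢n (trans (sym (raise-at n G x)) raised≡G))
    where
    quiet : ∀ {y w} → y < n → ∣ y - x ∣ ≤ suc (G x) → Hears n G y w → w ≡ x
    quiet {y} {w} y<n d h with w ≟ x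
    ... | yes w≡x = w≡x
    ... | no w≢x  = ⊥-elim (¬interference (y , y<n , d , w , w≢x , h))
    raised≡G : raise G x x ≡ G x
    raised≡G = maximal (raise-broadcast n G x broadcast room) (raise-packing n G x packing quiet) (λ _ → m≤n+m _ _) x<n

  uncovered-next-to-covered : 2 ≤ n → ∀ {u} → u < n → ¬ Covered n G u →
                              Covered n G (suc u) ⊎ ∃ λ u′ → u ≡ suc u′ × Covered n G u′
  uncovered-next-to-covered n≥2 {u} u<n ¬Cu = neighbour (raise-interferes u<n room)
    where
    G≡0 : G u ≡ 0
    G≡0 = n≤0⇒n≡0 (≮⇒≥ (λ G>0 → ¬Cu (u<n , u , u<n , G>0 , ≤-trans (≤-reflexive (∣n-n∣≡0 u)) z≤n)))
    room : suc (G u) ≤ eccℕ n u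
    room = subst (λ g → suc g ≤ eccℕ n u) (sym G≡0) (eccℕ≥1 u n≥2)
    neighbour : (∃ λ y → y < n × (∣ y - u ∣ ≤ suc (G u) × HearsOther n G u y)) →
                Covered n G (suc u) ⊎ ∃ λ u′ → u ≡ suc u′ × Covered n G u′
    neighbour (y , y<n , d , w , _ , h) with ∣ y - u ∣ ≤? 0
    ... | yes d≤0 = ⊥-elim (¬Cu (subst (Covered n G) (∣m-n∣≡0⇒m≡n (n≤0⇒n≡0 d≤0)) (y<n , w , h)))
    ... | no d≰0 with exact-distance {y} {u} {0} (subst (λ g → ∣ y - u ∣ ≤ suc g) G≡0 d) d≰0
    ...   | inj₁ y≡1+u = inj₁ (subst (Covered n G) (trans y≡1+u (cong suc (+-identityʳ u))) (y<n , w , h))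
    ...   | inj₂ u≡1+y = inj₂ (y , trans u≡1+y (cong suc (+-identityʳ y)) , y<n , w , h)

  broadcaster-blocked : ∀ {v} → v < n → 0 < G v → G v < eccℕ n v → LeftCovered n G v ⊎ RightCovered n G v
  broadcaster-blocked {v} v<n v>0 room with raise-interferes v<n room
  ... | y , y<n , d , w , w≢v , h with ∣ y - v ∣ ≤? G v
  ...   | yes d≤G = ⊥-elim (w≢v (packing y<n h (v<n , v>0 , d≤G)))
  ...   | no d≰G with exact-distance {y} {v} d d≰G
  ...     | inj₁ y≡1+v+G = inj₂ (subst (Covered n G) y≡1+v+G (y<n , w , h))
  ...     | inj₂ v≡1+y+G = inj₁ (subst (1 ≤_) (sym left-end) (s≤s z≤n) ,
                                 subst (Covered n G) (cong (_∸ 1) (sym left-end)) (y<n , w , h))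
    where
    left-end : v ∸ G v ≡ suc y
    left-end = trans (cong (_∸ G v) v≡1+y+G) (m+n∸n≡m (suc y) (G v))

-- Lower bound

-- The largest n with p_b(P_n) ≤ σ.
capacity : ℕ → ℕ
capacity zero          = 0
capacity (suc zero)    = 3
capacity (suc (suc σ)) = 8 + capacity σ

3σ+2a≤capacity : ∀ σ a → a + a ≤ σ → σ + σ + σ + (a + a) ≤ capacity σ
3σ+2a≤capacity zero          zero    _ = z≤n
3σ+2a≤capacity (suc zero)    zero    _ = ≤-refl
3σ+2a≤capacity (suc zero)    (suc a) (s≤s 2a+1≤0) = ⊥-elim (1+n≢0 (n≤0⇒n≡0 (≤-trans (m≤n+m (suc a) a) 2a+1≤0)))
3σ+2a≤capacity (suc (suc σ)) zero    _ = begin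
  2 + σ + (2 + σ) + (2 + σ) + 0  ≡⟨ lhs≡ σ ⟩
  6 + (σ + σ + σ + 0)            ≤⟨ +-mono-≤ (m≤m+n 6 2) (3σ+2a≤capacity σ 0 z≤n) ⟩
  8 + capacity σ                 ∎
  where
  open ≤-Reasoning
  lhs≡ : ∀ σ → 2 + σ + (2 + σ) + (2 + σ) + 0 ≡ 6 + (σ + σ + σ + 0)
  lhs≡ = solve-∀
3σ+2a≤capacity (suc (suc σ)) (suc a) 2+2a≤2+σ = begin
  2 + σ + (2 + σ) + (2 + σ) + (suc a + suc a) ≡⟨ lhs≡ σ a ⟩
  8 + (σ + σ + σ + (a + a))                   ≤⟨ +-monoʳ-≤ 8 (3σ+2a≤capacity σ a 2a≤σ) ⟩
  8 + capacity σ                              ∎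
  where
  open ≤-Reasoning
  lhs≡ : ∀ σ a → 2 + σ + (2 + σ) + (2 + σ) + (suc a + suc a) ≡ 8 + (σ + σ + σ + (a + a))
  lhs≡ = solve-∀
  2a≤σ : a + a ≤ σ
  2a≤σ = ≤-pred (≤-pred (≤-trans (≤-reflexive (cong suc (sym (+-suc a a)))) 2+2a≤2+σ))

σ+σ+m+2a≤capacity : ∀ {σ m a} → a + a ≤ m → m ≤ σ → σ + σ + m + (a + a) ≤ capacity σ
σ+σ+m+2a≤capacity {σ} {m} {a} 2a≤m m≤σ =
  ≤-trans (+-monoˡ-≤ (a + a) (+-monoʳ-≤ (σ + σ) m≤σ)) (3σ+2a≤capacity σ a (≤-trans 2a≤m m≤σ))

module Counting {n} {G : ℕ → ℕ} (packing : Packingℕ n G)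
  (gap     : ∀ {u} → u < n → ¬ Covered n G u → Covered n G (suc u) ⊎ ∃ λ u′ → u ≡ suc u′ × Covered n G u′)
  (blocked : ∀ {v} → v < n → 0 < G v → LeftCovered n G v ⊎ RightCovered n G v)
  where

  C? : Decidable (Covered n G)
  C? = covered? n G

  LeftCovered? : Decidable (LeftCovered n G)
  LeftCovered? v = 1 ≤? v ∸ G v ×-dec C? (v ∸ G v ∸ 1)

  broadcasts : ℕ
  broadcasts = count (λ v → 0 <? G v) n

  leftOpen leftClosed : ℕ
  leftOpen   = count (λ v → 0 <? G v ×-dec ¬? (LeftCovered? v)) n
  leftClosed = count (λ v → 0 <? G v ×-dec LeftCovered? v) n

  hears-end : ∀ {v} → v + G v < n → 0 < G v → Hears n G (v + G v) v
  hears-end {v} end<n v>0 = ≤-<-trans (m≤m+n v (G v)) end<n , v>0 , ≤-reflexive (∣m+n-m∣≡n v (G v))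

  covered≤2σ+broadcasts : count C? n ≤ ∑ n G + ∑ n G + broadcasts
  covered≤2σ+broadcasts = begin
    count C? n                                          ≤⟨ count≤∑count C? hears? n n (λ _ (_ , w , h) → w , proj₁ h , h) ⟩
    ∑ n (λ w → count (λ u → hears? u w) n)              ≤⟨ ∑-mono-≤ n (λ {w} _ → per-broadcaster w (0 <? G w)) ⟩
    ∑ n (λ w → G w + G w + χ (0 <? G w))                ≡⟨ ∑-distrib-+ n _ _ ⟩
    ∑ n (λ w → G w + G w) + broadcasts                  ≡⟨ cong (_+ broadcasts) (∑-distrib-+ n G G) ⟩
    ∑ n G + ∑ n G + broadcasts                          ∎
    where
    open ≤-Reasoning
    hears? : ∀ u w → Dec (Hears n G u w)
    hears? u w = w <? n ×-dec (0 <? G w ×-dec ∣ u - w ∣ ≤? G w)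
    per-broadcaster : ∀ w (w>0? : Dec (0 < G w)) → count (λ u → hears? u w) n ≤ G w + G w + χ w>0?
    per-broadcaster w (yes _) = begin
      count (λ u → hears? u w) n
        ≤⟨ count-mono (λ u → hears? u w) (λ u → ∣ u - w ∣ ≤? G w) n (λ _ h → proj₂ (proj₂ h)) ⟩
      count (λ u → ∣ u - w ∣ ≤? G w) n      ≤⟨ count-∣-∣≤ n w (G w) ⟩
      suc (G w + G w)                       ≡⟨ +-comm 1 _ ⟩
      G w + G w + 1                         ∎
    per-broadcaster w (no w≯0) =
      ≤-trans (≤-reflexive (count-none (λ u → hears? u w) n (λ _ h → w≯0 (proj₁ (proj₂ h))))) z≤n

  -- Each run of covered vertices begins at the left end of a left-open range.
  rises+first≤leftOpen : count (rise? C?) n + χ (C? 0) ≤ leftOpen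
  rises+first≤leftOpen = begin
    count (rise? C?) n + χ (C? 0)               ≤⟨ +-mono-≤ rises≤afterGap first≤atStart ⟩
    count afterGap? n + count atStart? n        ≡⟨ ∑-distrib-+ n _ _ ⟨
    ∑ n (λ v → χ (afterGap? v) + χ (atStart? v))
      ≤⟨ ∑-mono-≤ n (λ {v} _ → χ+χ≤χ (afterGap? v) (atStart? v) _ afterGap⇒open atStart⇒open disjoint) ⟩
    leftOpen                                     ∎
    where
    open ≤-Reasoning
    AfterGap : ℕ → Set
    AfterGap v = 0 < G v × (1 ≤ v ∸ G v × ¬ Covered n G (v ∸ G v ∸ 1))
    afterGap? : Decidable AfterGap
    afterGap? v = 0 <? G v ×-dec (1 ≤? v ∸ G v ×-dec ¬? (C? (v ∸ G v ∸ 1)))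
    AtStart : ℕ → Set
    AtStart v = 0 < G v × v ∸ G v ≡ 0
    atStart? : Decidable AtStart
    atStart? v = 0 <? G v ×-dec (v ∸ G v ≟ 0)
    afterGap⇒open : ∀ {v} → AfterGap v → 0 < G v × ¬ LeftCovered n G v
    afterGap⇒open (v>0 , _ , ¬C) = v>0 , ¬C ∘ proj₂
    atStart⇒open : ∀ {v} → AtStart v → 0 < G v × ¬ LeftCovered n G v
    atStart⇒open (v>0 , start≡0) = v>0 , λ (start≥1 , _) → 1+n≰n (≤-trans start≥1 (≤-reflexive start≡0))
    disjoint : ∀ {v} → AfterGap v → ¬ AtStart v
    disjoint (_ , start≥1 , _) (_ , start≡0) = 1+n≰n (≤-trans start≥1 (≤-reflexive start≡0))
    rises≤afterGap : count (rise? C?) n ≤ count afterGap? n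
    rises≤afterGap = count-≤-matching (rise? C?) (λ u v → rise? C? u ×-dec (0 <? G v ×-dec (v ∸ G v ≟ suc u))) n n afterGap?
      (λ {u} u<n (¬Cu , Cu+1@(_ , w , w<n , w>0 , d)) →
         w , w<n , (¬Cu , Cu+1) , w>0 , left-end-of-range d (λ d′ → ¬Cu (u<n , w , w<n , w>0 , d′)))
      (λ _ _ _ (_ , _ , e) (_ , _ , e′) → suc-injective (trans (sym e) e′))
      (λ _ _ ((¬Cu , _) , v>0 , e) → v>0 , subst (1 ≤_) (sym e) (s≤s z≤n) , subst (λ s → ¬ Covered n G (s ∸ 1)) (sym e) ¬Cu)
    first≤atStart : χ (C? 0) ≤ count atStart? n
    first≤atStart = χ≤count (C? 0) atStart? n (λ (_ , w , w<n , w>0 , d) → w , w<n , w>0 , m≤n⇒m∸n≡0 d)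

  uncovered≤2leftOpen : count (¬? ∘ C?) n ≤ leftOpen + leftOpen
  uncovered≤2leftOpen = begin
    count (¬? ∘ C?) n                              ≤⟨ count-¬≤rises+falls C? n gap ⟩
    count (rise? C?) n + count (fall? C?) n        ≡⟨ cong (count (rise? C?) n +_) falls≡rises+first ⟩
    count (rise? C?) n + (count (rise? C?) n + χ (C? 0))
      ≤⟨ +-mono-≤ (≤-trans (m≤m+n (count (rise? C?) n) (χ (C? 0))) rises+first≤leftOpen) rises+first≤leftOpen ⟩
    leftOpen + leftOpen                            ∎
    where
    open ≤-Reasoning
    falls≡rises+first : count (fall? C?) n ≡ count (rise? C?) n + χ (C? 0)
    falls≡rises+first = begin-equality
      count (fall? C?) n                 ≡⟨ +-identityʳ _ ⟨
      count (fall? C?) n + 0             ≡⟨ cong (count (fall? C?) n +_) (χ-no (C? n) (λ (n<n , _) → <-irrefl refl n<n)) ⟨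
      count (fall? C?) n + χ (C? n)      ≡⟨ falls+last≡rises+first C? n ⟩
      count (rise? C?) n + χ (C? 0)      ∎

  -- A left-open range is blocked on its right; the range covering the next vertex starts there
  -- and is left-closed, and it determines the left-open one.
  leftOpen≤leftClosed : leftOpen ≤ leftClosed
  leftOpen≤leftClosed = count-≤-matching _ R? n n _ related unique R⇒closed
    where
    R : ℕ → ℕ → Set
    R v w = (0 < G v × ¬ LeftCovered n G v) × (0 < G w × w ∸ G w ≡ suc (v + G v))
    R? : ∀ v w → Dec (R v w)
    R? v w = (0 <? G v ×-dec ¬? (LeftCovered? v)) ×-dec (0 <? G w ×-dec (w ∸ G w ≟ suc (v + G v)))
    related : ∀ {v} → v < n → 0 < G v × ¬ LeftCovered n G v → ∃ λ w → w < n × R v w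
    related {v} v<n isOpen@(v>0 , ¬L) with blocked v<n v>0
    ... | inj₁ L = ⊥-elim (¬L L)
    ... | inj₂ (s<n , w , w<n , w>0 , d) = w , w<n , isOpen , w>0 , left-end-of-range d end-unheard
      where
      end-unheard : ¬ ∣ v + G v - w ∣ ≤ G w
      end-unheard d′ with packing (≤-trans (n≤1+n _) s<n) (hears-end (≤-trans (n≤1+n _) s<n) v>0) (w<n , w>0 , d′)
      ... | refl = 1+n≰n (≤-trans (≤-reflexive (sym beyond)) d)
        where
        beyond : ∣ suc (v + G v) - v ∣ ≡ suc (G v)
        beyond = trans (cong (∣_- v ∣) (sym (+-suc v (G v)))) (∣m+n-m∣≡n v (suc (G v)))
    end<n : ∀ {v w} → w < n → w ∸ G w ≡ suc (v + G v) → v + G v < n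
    end<n {w = w} w<n e = <-trans (≤-trans (≤-reflexive (sym e)) (m∸n≤m w (G w))) w<n
    unique : ∀ {v v′ w} → v < n → v′ < n → w < n → R v w → R v′ w → v ≡ v′
    unique {v} {v′} _ _ w<n ((v>0 , _) , _ , e) ((v′>0 , _) , _ , e′) =
      packing (end<n w<n e) (hears-end (end<n w<n e) v>0)
              (subst (λ p → Hears n G p v′) (sym ends≡) (hears-end (end<n w<n e′) v′>0))
      where
      ends≡ : v + G v ≡ v′ + G v′
      ends≡ = suc-injective (trans (sym e) e′)
    R⇒closed : ∀ {v w} → v < n → w < n → R v w → 0 < G w × LeftCovered n G w
    R⇒closed {v} {w} _ w<n ((v>0 , _) , w>0 , e) =
      w>0 , subst (1 ≤_) (sym e) (s≤s z≤n) ,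
      subst (Covered n G) (cong (_∸ 1) (sym e)) (end<n w<n e , v , hears-end (end<n w<n e) v>0)

  leftOpen+leftClosed≤broadcasts : leftOpen + leftClosed ≤ broadcasts
  leftOpen+leftClosed≤broadcasts = begin
    leftOpen + leftClosed  ≡⟨ ∑-distrib-+ n _ _ ⟨
    ∑ n (λ v → χ (0 <? G v ×-dec ¬? (LeftCovered? v)) + χ (0 <? G v ×-dec LeftCovered? v))
      ≤⟨ ∑-mono-≤ n (λ {v} _ → χ+χ≤χ (0 <? G v ×-dec ¬? (LeftCovered? v)) (0 <? G v ×-dec LeftCovered? v) (0 <? G v)
                                   proj₁ proj₁ (λ (_ , ¬L) (_ , L) → ¬L L)) ⟩
    broadcasts             ∎
    where open ≤-Reasoning

  broadcasts≤σ : broadcasts ≤ ∑ n G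
  broadcasts≤σ = ∑-mono-≤ n (λ {v} _ → χ≤ (0 <? G v))
    where
    χ≤ : ∀ {g} (g>0? : Dec (0 < g)) → χ g>0? ≤ g
    χ≤ (yes g>0) = g>0
    χ≤ (no _)    = z≤n

  n≤capacity : n ≤ capacity (∑ n G)
  n≤capacity = begin
    n                                                    ≡⟨ count+count-¬≡n C? n ⟨
    count C? n + count (¬? ∘ C?) n                       ≤⟨ +-mono-≤ covered≤2σ+broadcasts uncovered≤2leftOpen ⟩
    ∑ n G + ∑ n G + broadcasts + (leftOpen + leftOpen)   ≤⟨ σ+σ+m+2a≤capacity {a = leftOpen} 2a≤broadcasts broadcasts≤σ ⟩
    capacity (∑ n G)                                     ∎
    where
    open ≤-Reasoning
    2a≤broadcasts : leftOpen + leftOpen ≤ broadcasts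
    2a≤broadcasts = ≤-trans (+-monoʳ-≤ leftOpen leftOpen≤leftClosed) leftOpen+leftClosed≤broadcasts

n≤capacity-cost : ∀ {n} {g : Fin n → ℕ} → 2 ≤ n → IsMaximalPacking n g → n ≤ capacity (cost g)
n≤capacity-cost {n} {g} n≥2 max = subst (λ c → n ≤ capacity c) (sym (cost≡∑-extend n g)) bound
  where
  G : ℕ → ℕ
  G = extend n g
  maxℕ : IsMaximalPackingℕ n G
  maxℕ = maximal→ℕ max
  open IsMaximalPackingℕ maxℕ using (packing)
  open Maximality maxℕ
  bound : n ≤ capacity (∑ n G)
  bound with anyUpTo? (λ v → 0 <? G v ×-dec eccℕ n v ≤? G v) n
  ... | no ¬saturated = Counting.n≤capacity packing (uncovered-next-to-covered n≥2)
          (λ v<n v>0 → broadcaster-blocked v<n v>0 (≰⇒> (λ ecc≤G → ¬saturated (_ , v<n , v>0 , ecc≤G))))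
  ... | yes (v , v<n , v>0 , ecc≤G) = begin
    n                               ≤⟨ n≤1+2ecc v<n ⟩
    suc (eccℕ n v + eccℕ n v)       ≤⟨ s≤s (+-mono-≤ ecc≤σ ecc≤σ) ⟩
    suc (∑ n G + ∑ n G)             ≤⟨ +-monoˡ-≤ (∑ n G + ∑ n G) (≤-trans v>0 (term≤∑ n G v<n)) ⟩
    ∑ n G + (∑ n G + ∑ n G)         ≡⟨ trans (+-identityʳ _) (+-assoc (∑ n G) _ _) ⟨
    ∑ n G + ∑ n G + ∑ n G + 0       ≤⟨ 3σ+2a≤capacity (∑ n G) 0 z≤n ⟩
    capacity (∑ n G)                ∎
    where
    open ≤-Reasoning
    ecc≤σ : eccℕ n v ≤ ∑ n G
    ecc≤σ = ≤-trans ecc≤G (term≤∑ n G v<n)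

-- Maximal unit patterns

-- Ones more than 2 apart form a packing.  It is maximal when no value can be raised: each 0 lies
-- within distance 2 of a one, and each one has another at distance 3 or satisfies Escape.
record UnitPattern (n : ℕ) (F : ℕ → ℕ) (Escape : ℕ → Set) : Set where
  field
    unit       : ∀ {u} → u < n → F u ≤ 1
    separated  : ∀ {v} → v < n → ∀ {w} → w < n → F v ≡ 1 → F w ≡ 1 → ∣ v - w ∣ ≤ 2 → v ≡ w
    partnered  : ∀ {v} → v < n → F v ≡ 1 → (∃ λ w → w < n × (F w ≡ 1 × ∣ v - w ∣ ≡ 3)) ⊎ Escape v
    dominating : ∀ {u} → u < n → ∃ λ w → w < n × (F w ≡ 1 × ∣ u - w ∣ ≤ 2)

unitPattern? : ∀ n F {E : ℕ → Set} → Decidable E → Dec (UnitPattern n F E)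
unitPattern? n F E?
  with allUpTo? (λ u → F u ≤? 1) n
     | allUpTo? (λ v → allUpTo? (λ w → (F v ≟ 1) →-dec ((F w ≟ 1) →-dec ((∣ v - w ∣ ≤? 2) →-dec (v ≟ w)))) n) n
     | allUpTo? (λ v → (F v ≟ 1) →-dec (anyUpTo? (λ w → F w ≟ 1 ×-dec ∣ v - w ∣ ≟ 3) n ⊎-dec E? v)) n
     | allUpTo? (λ u → anyUpTo? (λ w → F w ≟ 1 ×-dec ∣ u - w ∣ ≤? 2) n) n
... | yes u | yes s | yes p | yes d = yes record { unit = u ; separated = s ; partnered = p ; dominating = d }
... | no ¬u | _     | _     | _     = no λ r → ¬u (UnitPattern.unit r)
... | _     | no ¬s | _     | _     = no λ r → ¬s (UnitPattern.separated r)
... | _     | _     | no ¬p | _     = no λ r → ¬p (UnitPattern.partnered r)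
... | _     | _     | _     | no ¬d = no λ r → ¬d (UnitPattern.dominating r)

UnitPattern-map : ∀ {n F} {E E′ : ℕ → Set} → (∀ {v} → v < n → E v → E′ v) → UnitPattern n F E → UnitPattern n F E′
UnitPattern-map E⇒E′ p = record
  { unit = unit ; separated = separated ; dominating = dominating
  ; partnered = λ v<n Fv≡1 → Data.Sum.map₂ (E⇒E′ v<n) (partnered v<n Fv≡1)
  }
  where open UnitPattern p

unit-value : ∀ {x} → x ≤ 1 → 0 < x → x ≡ 1
unit-value (s≤s z≤n) (s≤s z≤n) = refl

module _ {n} {F : ℕ → ℕ} (n≥2 : 2 ≤ n) (isUnitPattern : UnitPattern n F (λ v → eccℕ n v ≤ 1)) where

  open UnitPattern isUnitPattern

  unit-pattern-packing : Packingℕ n F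
  unit-pattern-packing {u} {v} {w} u<n (v<n , v>0 , duv) (w<n , w>0 , duw) =
    separated v<n w<n Fv≡1 Fw≡1 (≤-trans (∣-∣-triangle v u w) (+-mono-≤ dvu duw′))
    where
    Fv≡1 : F v ≡ 1
    Fv≡1 = unit-value (unit v<n) v>0
    Fw≡1 : F w ≡ 1
    Fw≡1 = unit-value (unit w<n) w>0
    dvu : ∣ v - u ∣ ≤ 1
    dvu = subst₂ _≤_ (∣-∣-comm u v) Fv≡1 duv
    duw′ : ∣ u - w ∣ ≤ 1
    duw′ = subst (∣ u - w ∣ ≤_) Fw≡1 duw

  module _ {H : ℕ → ℕ} (bcH : Broadcastℕ n H) (pkH : Packingℕ n H) (F≤H : ∀ {x} → x < n → F x ≤ H x) where

    common-hearer⇒≡ : ∀ {x w u} → x < n → w < n → F w ≡ 1 → u ≤ x ⊔ w →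
                       0 < H x → ∣ u - x ∣ ≤ H x → ∣ u - w ∣ ≤ 1 → x ≡ w
    common-hearer⇒≡ x<n w<n Fw≡1 u≤x⊔w Hx>0 dux duw =
      pkH (≤-<-trans u≤x⊔w (⊔-lub x<n w<n)) (x<n , Hx>0 , dux) (w<n , Hw≥1 , ≤-trans duw Hw≥1)
      where
      Hw≥1 : 1 ≤ H _
      Hw≥1 = subst (_≤ _) Fw≡1 (F≤H w<n)

    zero-unraised : ∀ {x} → x < n → F x ≡ 0 → H x ≤ 0
    zero-unraised {x} x<n Fx≡0 = ≮⇒≥ λ Hx>0 → raised Hx>0 (dominating x<n)
      where
      raised : 0 < H x → (∃ λ w → w < n × (F w ≡ 1 × ∣ x - w ∣ ≤ 2)) → ⊥
      raised Hx>0 (w , w<n , Fw≡1 , d) with midpoint d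
      ... | u , u≤x⊔w , dux , duw =
        0≢1+n (trans (sym Fx≡0) (trans (cong F (common-hearer⇒≡ x<n w<n Fw≡1 u≤x⊔w Hx>0 (≤-trans dux Hx>0) duw)) Fw≡1))

    one-unraised : ∀ {x} → x < n → F x ≡ 1 → H x ≤ 1
    one-unraised {x} x<n Fx≡1 with partnered x<n Fx≡1
    ... | inj₂ ecc≤1 = ≤-trans (bcH x<n) ecc≤1
    ... | inj₁ (w , w<n , Fw≡1 , d≡3) =
      ≮⇒≥ λ Hx≥2 → 0≢1+n (trans (sym (∣n-n∣≡0 w)) (subst (λ y → ∣ y - w ∣ ≡ 3) (x≡w Hx≥2) d≡3))
      where
      x≡w : 1 < H x → x ≡ w
      x≡w Hx≥2 with two-and-one-from-three d≡3
      ... | u , u≤x⊔w , dux , duw = common-hearer⇒≡ x<n w<n Fw≡1 u≤x⊔w (≤-trans (n≤1+n 1) Hx≥2) (≤-trans dux Hx≥2) duw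

  unit-pattern-maximal : IsMaximalPackingℕ n F
  unit-pattern-maximal = record
    { broadcast = λ {x} x<n → ≤-trans (unit x<n) (eccℕ≥1 x n≥2)
    ; packing   = unit-pattern-packing
    ; maximal   = λ bcH pkH F≤H {x} x<n → ≤-antisym (H≤F bcH pkH F≤H x<n (n≤1⇒n≡0∨n≡1 (unit x<n))) (F≤H x<n)
    }
    where
    H≤F : ∀ {H} → Broadcastℕ n H → Packingℕ n H → (∀ {x} → x < n → F x ≤ H x) →
          ∀ {x} → x < n → F x ≡ 0 ⊎ F x ≡ 1 → H x ≤ F x
    H≤F {H} bcH pkH F≤H {x} x<n (inj₁ Fx≡0) = subst (H x ≤_) (sym Fx≡0) (zero-unraised bcH pkH F≤H x<n Fx≡0)
    H≤F {H} bcH pkH F≤H {x} x<n (inj₂ Fx≡1) = subst (H x ≤_) (sym Fx≡1) (one-unraised bcH pkH F≤H x<n Fx≡1)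

Cheap : ℕ → (ℕ → ℕ) → Set
Cheap n F = ∀ {σ} → n ≤ capacity σ → ∑ n F ≤ σ

unit-pattern-optimal : ∀ {n} {F : ℕ → ℕ} → 2 ≤ n → UnitPattern n F (λ v → eccℕ n v ≤ 1) → Cheap n F →
                       Σ (Fin n → ℕ) (λ f → IsPbBroadcast n f × (∀ v → 0 < f v → f v ≡ 1))
unit-pattern-optimal {n} {F} n≥2 isUnitPattern cheap =
  (λ (i : Fin n) → F (toℕ i)) , (maximal←ℕ (unit-pattern-maximal n≥2 isUnitPattern) , optimal) ,
  λ i → unit-value (UnitPattern.unit isUnitPattern (toℕ<n i))
  where
  optimal : ∀ g → IsMaximalPacking n g → cost (λ (i : Fin n) → F (toℕ i)) ≤ cost g
  optimal g max = subst (_≤ cost g) (sym (cost≡∑ n F)) (cheap (n≤capacity-cost n≥2 max))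

-- The construction

block : ℕ → ℕ
block 2 = 1
block 5 = 1
block _ = 0

block-pattern : UnitPattern 8 block (λ _ → ⊥)
block-pattern = toWitness {a? = unitPattern? 8 block (λ _ → no id)} _

block-ones≤5 : ∀ {v} → v < 8 → block v ≡ 1 → v ≤ 5
block-ones≤5 = toWitness {a? = allUpTo? (λ v → (block v ≟ 1) →-dec (v ≤? 5)) 8} _

pattern 8+ m = suc (suc (suc (suc (suc (suc (suc (suc m)))))))

-- Ones on the last n mod 8 vertices.  For three vertices the one sits at 0, partnered by the 5 of
-- the preceding block; on P_3 alone this is not maximal, which is why P_3 uses centre.
remainder : ℕ → ℕ → ℕ
remainder 1 0 = 1
remainder 2 0 = 1
remainder 3 0 = 1
remainder 4 0 = 1
remainder 4 3 = 1
remainder 5 0 = 1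
remainder 5 3 = 1
remainder 6 2 = 1
remainder 6 5 = 1
remainder 7 2 = 1
remainder 7 5 = 1
remainder _ _ = 0

glue : (ℕ → ℕ) → ℕ → ℕ
glue F u with u <? 8
... | yes _ = block u
... | no _  = F (u ∸ 8)

blocks : ℕ → ℕ → ℕ
blocks (8+ m) = glue (blocks m)
blocks m      = remainder m

short-or-long : ∀ n → (n < 8 × blocks n ≡ remainder n) ⊎ ∃ λ m → n ≡ 8+ m
short-or-long (8+ m) = inj₂ (m , refl)
short-or-long 0 = inj₁ (<ᵇ⇒< 0 8 _ , refl)
short-or-long 1 = inj₁ (<ᵇ⇒< 1 8 _ , refl)
short-or-long 2 = inj₁ (<ᵇ⇒< 2 8 _ , refl)
short-or-long 3 = inj₁ (<ᵇ⇒< 3 8 _ , refl)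
short-or-long 4 = inj₁ (<ᵇ⇒< 4 8 _ , refl)
short-or-long 5 = inj₁ (<ᵇ⇒< 5 8 _ , refl)
short-or-long 6 = inj₁ (<ᵇ⇒< 6 8 _ , refl)
short-or-long 7 = inj₁ (<ᵇ⇒< 7 8 _ , refl)

low-or-high : ∀ u → u < 8 ⊎ ∃ λ u′ → u ≡ 8+ u′
low-or-high u with u <? 8
... | yes u<8 = inj₁ u<8
... | no u≮8  = inj₂ (u ∸ 8 , sym (m+[n∸m]≡n (≮⇒≥ u≮8)))

glue-low : ∀ {F u} → u < 8 → glue F u ≡ block u
glue-low {u = u} u<8 with u <? 8
... | yes _  = refl
... | no u≮8 = ⊥-elim (u≮8 u<8)

glue-pattern : ∀ {m F} → UnitPattern m F (λ v → v ≡ 0 × m ≤ 3) → UnitPattern (8+ m) (glue F) (λ v → v ≡ 0 × 8+ m ≤ 3)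
glue-pattern {m} {F} p = record { unit = unit ; separated = separated ; partnered = partnered ; dominating = dominating }
  where
  module P = UnitPattern p
  module B = UnitPattern block-pattern
  low<8+m : ∀ {u} → u < 8 → u < 8+ m
  low<8+m u<8 = <-≤-trans u<8 (m≤m+n 8 m)
  high<m : ∀ {u} → 8+ u < 8+ m → u < m
  high<m = +-cancelˡ-< 8 _ _
  unit : ∀ {u} → u < 8+ m → glue F u ≤ 1
  unit {u} u< with low-or-high u
  ... | inj₁ u<8        = subst (_≤ 1) (sym (glue-low u<8)) (B.unit u<8)
  ... | inj₂ (u′ , refl) = P.unit (high<m u<)
  far-apart : ∀ {v w′} → v < 8 → block v ≡ 1 → ¬ ∣ v - 8+ w′ ∣ ≤ 2
  far-apart {v} {w′} v<8 Bv≡1 d =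
    1+n≰n (≤-trans (m≤m+n 8 w′) (≤-trans (proj₂ (∣-∣≤⇒ d)) (+-monoˡ-≤ 2 (block-ones≤5 v<8 Bv≡1))))
  separated : ∀ {v} → v < 8+ m → ∀ {w} → w < 8+ m → glue F v ≡ 1 → glue F w ≡ 1 → ∣ v - w ∣ ≤ 2 → v ≡ w
  separated {v} v< {w} w< Fv≡1 Fw≡1 d with low-or-high v | low-or-high w
  ... | inj₁ v<8         | inj₁ w<8         =
    B.separated v<8 w<8 (trans (sym (glue-low v<8)) Fv≡1) (trans (sym (glue-low w<8)) Fw≡1) d
  ... | inj₂ (v′ , refl) | inj₂ (w′ , refl) = cong (8 +_) (P.separated (high<m v<) (high<m w<) Fv≡1 Fw≡1 d)
  ... | inj₁ v<8         | inj₂ (w′ , refl) = ⊥-elim (far-apart v<8 (trans (sym (glue-low v<8)) Fv≡1) d)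
  ... | inj₂ (v′ , refl) | inj₁ w<8         =
    ⊥-elim (far-apart w<8 (trans (sym (glue-low w<8)) Fw≡1) (subst (_≤ 2) (∣-∣-comm v w) d))
  partnered : ∀ {v} → v < 8+ m → glue F v ≡ 1 →
              (∃ λ w → w < 8+ m × (glue F w ≡ 1 × ∣ v - w ∣ ≡ 3)) ⊎ (v ≡ 0 × 8+ m ≤ 3)
  partnered {v} v< Fv≡1 with low-or-high v
  ... | inj₁ v<8 with B.partnered v<8 (trans (sym (glue-low v<8)) Fv≡1)
  ...   | inj₁ (w , w<8 , Bw≡1 , d) = inj₁ (w , low<8+m w<8 , trans (glue-low w<8) Bw≡1 , d)
  partnered {v} v< Fv≡1 | inj₂ (v′ , refl) with P.partnered (high<m v<) Fv≡1
  ...   | inj₁ (w′ , w′<m , Fw′≡1 , d) = inj₁ (8+ w′ , +-monoʳ-< 8 w′<m , Fw′≡1 , d)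
  ...   | inj₂ (refl , _)              = inj₁ (5 , low<8+m (<ᵇ⇒< 5 8 _) , refl , refl)
  dominating : ∀ {u} → u < 8+ m → ∃ λ w → w < 8+ m × (glue F w ≡ 1 × ∣ u - w ∣ ≤ 2)
  dominating {u} u< with low-or-high u
  ... | inj₁ u<8 with B.dominating u<8
  ...   | w , w<8 , Bw≡1 , d = w , low<8+m w<8 , trans (glue-low w<8) Bw≡1 , d
  dominating {u} u< | inj₂ (u′ , refl) with P.dominating (high<m u<)
  ...   | w′ , w′<m , Fw′≡1 , d = 8+ w′ , +-monoʳ-< 8 w′<m , Fw′≡1 , d

remainder-pattern : ∀ {m} → m < 8 → UnitPattern m (remainder m) (λ v → v ≡ 0 × m ≤ 3)
remainder-pattern = toWitness {a? = allUpTo? (λ m → unitPattern? m (remainder m) (λ v → v ≟ 0 ×-dec m ≤? 3)) 8} _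

blocks-pattern : ∀ n → UnitPattern n (blocks n) (λ v → v ≡ 0 × n ≤ 3)
blocks-pattern n with short-or-long n
... | inj₁ (n<8 , blocks≡remainder) =
  subst (λ F → UnitPattern n F (λ v → v ≡ 0 × n ≤ 3)) (sym blocks≡remainder) (remainder-pattern n<8)
... | inj₂ (m , refl)               = glue-pattern (blocks-pattern m)

remainder-cheap : ∀ {m} → m < 8 → Cheap m (remainder m)
remainder-cheap {m} m<8 {zero} m≤0 with n≤0⇒n≡0 m≤0
... | refl = z≤n
remainder-cheap m<8 {suc zero} m≤3 =
  toWitness {a? = allUpTo? (λ m → ∑ m (remainder m) ≤? 1) 4} _ (s≤s m≤3)
remainder-cheap m<8 {suc (suc σ)} _ =
  ≤-trans (toWitness {a? = allUpTo? (λ m → ∑ m (remainder m) ≤? 2) 8} _ m<8) (m≤m+n 2 σ)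

glue-cheap : ∀ {m F} → Cheap m F → Cheap (8+ m) (glue F)
glue-cheap cheap {suc (suc σ)} 8+m≤8+cap = s≤s (s≤s (cheap (+-cancelˡ-≤ 8 _ _ 8+m≤8+cap)))
glue-cheap cheap {suc zero} (s≤s (s≤s (s≤s ())))

blocks-cheap : ∀ n → Cheap n (blocks n)
blocks-cheap n with short-or-long n
... | inj₁ (n<8 , blocks≡remainder) = subst (Cheap n) (sym blocks≡remainder) (remainder-cheap n<8)
... | inj₂ (m , refl)               = glue-cheap (blocks-cheap m)

centre : ℕ → ℕ
centre 1 = 1
centre _ = 0

centre-pattern : UnitPattern 3 centre (λ v → eccℕ 3 v ≤ 1)
centre-pattern = toWitness {a? = unitPattern? 3 centre (λ v → eccℕ 3 v ≤? 1)} _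

centre-cheap : Cheap 3 centre
centre-cheap {suc σ} _ = s≤s z≤n

short-escape⇒ecc≤1 : ∀ {n v} → 2 ≤ n → n ≢ 3 → v ≡ 0 × n ≤ 3 → eccℕ n v ≤ 1
short-escape⇒ecc≤1 {2}                     _        _   (refl , _)                 = ≤-refl
short-escape⇒ecc≤1 {3}                     _        n≢3 _                          = ⊥-elim (n≢3 refl)
short-escape⇒ecc≤1 {1}                     (s≤s ()) _   _
short-escape⇒ecc≤1 {suc (suc (suc (suc n)))} _      _   (_ , s≤s (s≤s (s≤s ())))

lemma3p15 : (n : ℕ) → 2 ≤ n →
    Σ (Fin n → ℕ) (λ f → IsPbBroadcast n f × (∀ v → 0 < f v → f v ≡ 1))
lemma3p15 n n≥2 with n ≟ 3
... | yes refl = unit-pattern-optimal n≥2 centre-pattern centre-cheap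
... | no n≢3   =
  unit-pattern-optimal n≥2 (UnitPattern-map (λ _ → short-escape⇒ecc≤1 n≥2 n≢3) (blocks-pattern n)) (blocks-cheap n)
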